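{- Let $n\ge 1$. If for every $k\in\{1,\dots,n\}$ there exists an MH-maximal family on a ground set of size $2k+1$, then there exists an H-maximal family on a ground set of size $2n+1$.
   Context: A weighted graph is a graph whose edges each have weight $1$ or $2$. A Hamiltonian path $H$ on the vertex set of a weighted graph $G$ is $G$-type if for every edge $uv$ of $G$ of weight $w$, the distance between $u$ and $v$ in $H$ is exactly $w$. For $k\ge1$, a $k$-ladder is a weighted graph on vertices $v_1,\dots,v_k,w_1,\dots,w_k$ with weight-$1$ edges $v_iw_i$ ($1\le i\le k$) and weight-$2$ edges $v_iv_{i+1},w_iw_{i+1}$ ($1\le i\le k-1$), with $(v_1,w_1)$ designated as top and $(v_k,w_k)$ as bottom. A weighted graph is properly laddered if it is the vertex-disjoint union of ladders, one isolated vertex $x_0$ (the apex), and a residual part which is either empty, a single edge, or the union of two vertex-disjoint paths on $m+2$ and $m$ vertices ($m\ge1$), all residual edges having weight $2$. Two weighted graphs on the same vertex set are compatible if some edge belongs to both with different weights; a family is compatible if every two of its members are compatible. Z-swapping construction applied to a properly laddered $G$ with $l$ ladders: all produced Hamiltonian paths begin with a common initial segment: (a) if the residual part is empty, the segment is the single vertex $x_0$; (b) if it is a single edge $x_1x_2$, the segment is $x_1x_0x_2$; (c) if it consists of paths $x_1x_2\dots x_m$ and $y_1y_2\dots y_{m+2}$, the segment is $y_1x_1y_2x_2\dots y_mx_my_{m+1}x_0y_{m+2}$. Fix an ordering of the ladders; for each $0$-$1$ sequence $s$ of length $l$, continue the path from the end of the initial segment by visiting the ladders in order, traversing the $i$-th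 ladder (with top $(v_1,w_1)$) either as $v_1w_1v_2w_2\dots v_kw_k$ or as $w_1v_1w_2v_2\dots w_kv_k$ according to the $i$-th entry of $s$. This yields $2^l$ Hamiltonian paths. Applying the construction to a family of properly laddered weighted graphs means taking the union of the sets of paths obtained for its members. A compatible family $\mathcal F$ of properly laddered weighted graphs on a ground set of size $2n+1$ is H-maximal if applying the Z-swapping construction to $\mathcal F$ yields $\binom{2n+1}{n}$ Hamiltonian paths. A compatible family $\mathcal F$ of properly laddered weighted graphs on a ground set of size $2k+1$ is MH-maximal if there is a matching $M$ of size $k$ contained in every graph of $\mathcal F$, with every edge of $M$ having weight $2$ in every graph of $\mathcal F$, and applying the Z-swapping construction to $\mathcal F$ yields $\binom{k}{\lfloor k/2\rfloor}$ Hamiltonian paths. -}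

module Defs where

open import Data.Nat using (ℕ; zero; suc; _+_; _*_; _≤_; ⌊_/2⌋)
open import Data.Nat.Combinatorics using (_C_)
open import Data.Fin using (Fin)
open import Data.List using (List; []; _∷_; _++_; length; concatMap; map; allFin; reverse)
open import Data.List.Membership.Propositional using (_∈_)
open import Data.List.Relation.Unary.Any using (Any)
open import Data.List.Relation.Unary.All using (All)
open import Data.List.Relation.Unary.AllPairs using (AllPairs)
open import Data.List.Relation.Unary.Unique.Propositional using (Unique)
open import Data.List.Relation.Binary.Permutation.Propositional using (_↭_)
open import Data.Product using (Σ; ∃; _×_; _,_)
open import Data.Sum using (_⊎_)
open import Relation.Binary.PropositionalEquality using (_≡_; _≢_)
open import Relation.Nullary using (¬_)

data Weight : Set where
  one two : Weight

-- A k-ladder (k ≥ 1) on vertices of Fin N, given by its top rung (v₁ , w₁)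
-- followed by the remaining rungs (v₂ , w₂) … (v_k , w_k) in order.
record Ladder (N : ℕ) : Set where
  constructor ladder
  field
    top  : Fin N × Fin N
    rest : List (Fin N × Fin N)
open Ladder public

rungs : ∀ {N} → Ladder N → List (Fin N × Fin N)
rungs L = top L ∷ rest L

-- Residual part: empty, a single edge x₁x₂, or two paths
-- x₁…x_m and y₁…y_{m+2} with m ≥ 1 (all residual edges have weight 2).
data Residual (N : ℕ) : Set where
  empty : Residual N
  edge  : Fin N → Fin N → Residual N
  paths : (xs ys : List (Fin N)) → 1 ≤ length xs → length ys ≡ 2 + length xs → Residual N

-- A properly laddered weighted graph on Fin N, presented together with its
-- decomposition: apex, residual part, and the (ordered) list of ladders.
residualVertices : ∀ {N} → Residual N → List (Fin N)
residualVertices empty = []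
residualVertices (edge a b) = a ∷ b ∷ []
residualVertices (paths xs ys _ _) = xs ++ ys

ladderVertices : ∀ {N} → Ladder N → List (Fin N)
ladderVertices L = concatMap (λ { (v , w) → v ∷ w ∷ [] }) (rungs L)

record Laddered (N : ℕ) : Set where
  constructor laddered
  field
    apex      : Fin N
    residual  : Residual N
    ladders   : List (Ladder N)
    partition : (apex ∷ residualVertices residual ++ concatMap ladderVertices ladders) ↭ allFin N
open Laddered public

-- Weighted edges (as ordered triples; edges are unordered, see EdgeIn).
WEdge : ℕ → Set
WEdge N = Fin N × Fin N × Weight

pathEdges : ∀ {N} → List (Fin N) → List (WEdge N)
pathEdges [] = []
pathEdges (a ∷ []) = []
pathEdges (a ∷ b ∷ xs) = (a , b , two) ∷ pathEdges (b ∷ xs)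

ladderEdges : ∀ {N} → Ladder N → List (WEdge N)
ladderEdges L =
  map (λ { (v , w) → (v , w , one) }) (rungs L)
  ++ pathEdges (map (λ { (v , w) → v }) (rungs L))
  ++ pathEdges (map (λ { (v , w) → w }) (rungs L))

residualEdges : ∀ {N} → Residual N → List (WEdge N)
residualEdges empty = []
residualEdges (edge a b) = (a , b , two) ∷ []
residualEdges (paths xs ys _ _) = pathEdges xs ++ pathEdges ys

edges : ∀ {N} → Laddered N → List (WEdge N)
edges G = residualEdges (residual G) ++ concatMap ladderEdges (ladders G)

EdgeIn : ∀ {N} → Laddered N → Fin N → Fin N → Weight → Set
EdgeIn G u v w = ((u , v , w) ∈ edges G) ⊎ ((v , u , w) ∈ edges G)

Compatible : ∀ {N} → Laddered N → Laddered N → Set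
Compatible G H = ∃ λ u → ∃ λ v → ∃ λ w → ∃ λ w' → EdgeIn G u v w × EdgeIn H u v w' × w ≢ w'

CompatibleFamily : ∀ {N} → List (Laddered N) → Set
CompatibleFamily F = AllPairs Compatible F

interleaveSeg : ∀ {N} → Fin N → List (Fin N) → List (Fin N) → List (Fin N)
interleaveSeg x0 (y ∷ ys) (x ∷ xs) = y ∷ x ∷ interleaveSeg x0 ys xs
interleaveSeg x0 (a ∷ b ∷ []) [] = a ∷ x0 ∷ b ∷ []
interleaveSeg x0 ys xs = ys ++ xs   -- unreachable for well-formed residuals

initialSegment : ∀ {N} → Fin N → Residual N → List (Fin N)
initialSegment x0 empty = x0 ∷ []
initialSegment x0 (edge x1 x2) = x1 ∷ x0 ∷ x2 ∷ []
initialSegment x0 (paths xs ys _ _) = interleaveSeg x0 ys xs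

traverse0 traverse1 : ∀ {N} → Ladder N → List (Fin N)
traverse0 L = concatMap (λ { (v , w) → v ∷ w ∷ [] }) (rungs L)
traverse1 L = concatMap (λ { (v , w) → w ∷ v ∷ [] }) (rungs L)

traversal : ∀ {N} → Ladder N → Fin 2 → List (Fin N)
traversal L Fin.zero = traverse0 L
traversal L (Fin.suc _) = traverse1 L

continuation : ∀ {N} → List (Ladder N) → List (Fin 2) → List (Fin N)
continuation [] _ = []
continuation (L ∷ Ls) [] = []
continuation (L ∷ Ls) (b ∷ bs) = traversal L b ++ continuation Ls bs

binarySeqs : ℕ → List (List (Fin 2))
binarySeqs zero = [] ∷ []
binarySeqs (suc l) = concatMap (λ s → (Fin.zero ∷ s) ∷ (Fin.suc Fin.zero ∷ s) ∷ []) (binarySeqs l)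

zPaths : ∀ {N} → Laddered N → List (List (Fin N))
zPaths G = map (λ s → initialSegment (apex G) (residual G) ++ continuation (ladders G) s)
               (binarySeqs (length (ladders G)))

zPathsFamily : ∀ {N} → List (Laddered N) → List (List (Fin N))
zPathsFamily F = concatMap zPaths F

SamePath : ∀ {N} → List (Fin N) → List (Fin N) → Set
SamePath p q = (p ≡ q) ⊎ (p ≡ reverse q)

YieldsPaths : ∀ {N} → List (Laddered N) → ℕ → Set
YieldsPaths F c = Σ (List (List (Fin _))) λ P →
    length P ≡ c
  × AllPairs (λ p q → ¬ SamePath p q) P
  × All (λ p → Any (SamePath p) (zPathsFamily F)) P
  × All (λ p → Any (SamePath p) P) (zPathsFamily F)

HMaximal : (n : ℕ) → List (Laddered (suc (2 * n))) → Set
HMaximal n F = CompatibleFamily F × YieldsPaths F ((suc (2 * n)) C n)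

IsMatching : ∀ {N} → ℕ → List (Fin N × Fin N) → Set
IsMatching k M = (length M ≡ k) × Unique (concatMap (λ { (a , b) → a ∷ b ∷ [] }) M)

MHMaximal : (k : ℕ) → List (Laddered (suc (2 * k))) → Set
MHMaximal k F =
    CompatibleFamily F
  × (Σ (List (Fin (suc (2 * k)) × Fin (suc (2 * k)))) λ M →
        IsMatching k M
      × All (λ e → All (λ G → EdgeIn G (Data.Product.proj₁ e) (Data.Product.proj₂ e) two) F) M)
  × YieldsPaths F (k C ⌊ k /2⌋)

-- Split the ground set Fin (2n+1) into the apex 0 and n pairs. For each 0-1 vector s of length n
-- with k ones, take an MH-maximal family on 2k+1 points, relabel it so that its matching lands on
-- the pairs selected by s and the vertex it misses on 0, and add every unselected pair as a
-- 1-ladder; this multiplies its number of Z-paths by 2^(n-k). A pair selected in s but not in s′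
-- is a weight-2 edge in one family and a rung of weight 1 in the other, so the union over all s is
-- compatible. Z-paths of compatible graphs are distinct, because a Z-path realises every edge at
-- its weight and a duplicate-free sequence puts two vertices at only one distance. So the union
-- yields Σ_s 2^(n-k) C(k, ⌊k/2⌋) paths: the coefficient of xⁿ in (1+x)(2x + 1 + x²)ⁿ = (1+x)^(2n+1).

module Submission where

open import Defs
open import Data.Nat using (ℕ; zero; suc; _+_; _*_; _^_; _≤_; _<_; z≤n; s≤s; ⌊_/2⌋)
open import Data.Nat.Properties
  using (suc-injective; ≤-reflexive; ≤-pred; <⇒≱; ≤-antisym; m≤n+m; +-assoc; +-comm; +-suc; +-identityʳ;
         *-suc; *-comm; *-assoc; *-zeroʳ; *-distribˡ-+; ^-distribˡ-+-*)
open import Data.Nat.Combinatorics using (_C_; nCk+nC[k+1]≡[n+1]C[k+1])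
open import Data.Nat.Tactic.RingSolver using (solve-∀)
open import Data.Bool using (Bool; true; false)
open import Data.Vec using (Vec; []; _∷_; toList)
import Data.Vec.Properties as Vec
open import Data.Fin using (Fin; zero; suc; _≟_)
open import Data.List using (List; []; _∷_; _++_; [_]; length; map; concatMap; reverse; allFin; tabulate)
open import Data.List.Properties
  using (length-++; length-map; length-tabulate; length-removeAt′; map-++; map-∘; map-cong; map-cong-local;
         concatMap-map; concatMap-cong; map-concatMap; concatMap-++; ++-assoc; ++-cancelˡ; ∷-injectiveˡ; ∷-injectiveʳ;
         reverse-++; reverse-involutive)
open import Data.List.Reverse using (reverseView; []; _∶_∶ʳ_)
open import Data.List.Membership.Propositional using (_∈_; _∉_)
open import Data.List.Membership.Propositional.Properties using (∈-++⁺ˡ; ∈-++⁺ʳ; ∈-map⁺; ∈-map⁻; ∈-allFin)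
import Data.List.Membership.DecPropositional as DecMembership
import Data.List.Membership.Setoid as SetoidMembership
open import Data.List.Relation.Unary.Any as Any using (Any; here; there; _─_)
open import Data.List.Relation.Unary.All as All using (All; []; _∷_)
import Data.List.Relation.Unary.All.Properties as All
open import Data.List.Relation.Unary.AllPairs as AllPairs using (AllPairs; []; _∷_)
import Data.List.Relation.Unary.AllPairs.Properties as AllPairs
open import Data.List.Relation.Unary.Unique.Propositional using (Unique)
open import Data.List.Relation.Unary.Unique.Propositional.Properties using (allFin⁺)
import Data.List.Relation.Unary.Unique.Setoid as SetoidUnique
open import Data.List.Relation.Binary.Permutation.Propositional as ↭ using (_↭_; ↭-sym; ↭⇒↭ₛ)
import Data.List.Relation.Binary.Permutation.Propositional.Properties as ↭
import Data.List.Relation.Binary.Permutation.Setoid.Properties as SetoidPermutation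
open import Data.Product using (Σ; ∃; ∃₂; _×_; _,_; proj₁; proj₂)
open import Data.Sum as Sum using (_⊎_; inj₁; inj₂)
open import Data.Empty using (⊥; ⊥-elim)
open import Function using (_∘_; id)
open import Relation.Binary.Bundles using (Setoid)
open import Relation.Binary.PropositionalEquality
  using (_≡_; _≢_; refl; sym; trans; cong; cong₂; subst; setoid; module ≡-Reasoning)
open import Relation.Nullary using (¬_; yes; no)

private
  variable
    A B : Set
    N K : ℕ

-- Lists without repetition

unique-resp-↭ : {xs ys : List A} → xs ↭ ys → Unique xs → Unique ys
unique-resp-↭ {A = A} xs↭ys = SetoidPermutation.Unique-resp-↭ (setoid A) (↭⇒↭ₛ xs↭ys)

unique-++ʳ : (xs : List A) {ys : List A} → Unique (xs ++ ys) → Unique ys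
unique-++ʳ []       u       = u
unique-++ʳ (x ∷ xs) (_ ∷ u) = unique-++ʳ xs u

prefix-unique : (l l′ : List A) {a : A} {r r′ : List A} →
  Unique (l ++ a ∷ r) → l ++ a ∷ r ≡ l′ ++ a ∷ r′ → l ≡ l′
prefix-unique []      []       _         _  = refl
prefix-unique []      (b ∷ l′) (a∉ ∷ _)  eq =
  ⊥-elim (All.lookup a∉ (subst (_ ∈_) (sym (∷-injectiveʳ eq)) (∈-++⁺ʳ l′ (here refl))) refl)
prefix-unique (b ∷ l) []       (b∉ ∷ _)  eq = ⊥-elim (All.lookup b∉ (∈-++⁺ʳ l (here refl)) (∷-injectiveˡ eq))
prefix-unique (b ∷ l) (b′ ∷ l′) (_ ∷ u)  eq =
  cong₂ _∷_ (∷-injectiveˡ eq) (prefix-unique l l′ u (∷-injectiveʳ eq))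

prefix-not-reverse : (p q q′ : List A) → p ≢ [] → q′ ≢ [] → Unique (p ++ q′) → p ++ q ≢ reverse (p ++ q′)
prefix-not-reverse []      _ _  p≢[] _ _ _ = p≢[] refl
prefix-not-reverse (h ∷ t) q q′ _ q′≢[] u eq with reverseView q′
... | []            = q′≢[] refl
... | r ∶ _ ∶ʳ y with u
...   | h∉ ∷ _ = All.lookup h∉ (∈-++⁺ʳ t (∈-++⁺ʳ r (here refl))) h≡y
  where
  h≡y : h ≡ y
  h≡y = ∷-injectiveˡ (trans eq (trans (cong reverse (sym (++-assoc (h ∷ t) r [ y ])))
                                     (reverse-++ (h ∷ t ++ r) [ y ])))

module Pigeonhole {c ℓ} (S : Setoid c ℓ) where
  open Setoid S using (_≈_) renaming (Carrier to C; trans to ≈-trans; sym to ≈-sym)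
  open SetoidMembership S using () renaming (_∈_ to _∈ₛ_)
  open SetoidUnique S using () renaming (Unique to Uniqueₛ)

  ∈-─ : {x y : C} {ys : List C} (x∈ : x ∈ₛ ys) → y ∈ₛ ys → ¬ x ≈ y → y ∈ₛ (ys ─ x∈)
  ∈-─ (here x≈z)  (here y≈z)  x≉y = ⊥-elim (x≉y (≈-trans x≈z (≈-sym y≈z)))
  ∈-─ (here _)    (there y∈)  _   = y∈
  ∈-─ (there _)   (here y≈z)  _   = here y≈z
  ∈-─ (there x∈)  (there y∈)  x≉y = there (∈-─ x∈ y∈ x≉y)

  ⊆-─ : {x : C} {xs ys : List C} (x∈ : x ∈ₛ ys) →
    All (λ y → ¬ x ≈ y) xs → All (_∈ₛ ys) xs → All (_∈ₛ (ys ─ x∈)) xs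
  ⊆-─ x∈ x≉xs xs⊆ys = All.zipWith (λ (x≉y , y∈) → ∈-─ x∈ y∈ x≉y) (x≉xs , xs⊆ys)

  unique-⊆⇒length-≤ : {xs ys : List C} → Uniqueₛ xs → All (_∈ₛ ys) xs → length xs ≤ length ys
  unique-⊆⇒length-≤ {[]}     []          []           = z≤n
  unique-⊆⇒length-≤ {x ∷ xs} {ys} (x≉xs ∷ u) (x∈ ∷ xs⊆ys) =
    subst (suc (length xs) ≤_) (sym (length-removeAt′ ys (Any.index x∈)))
      (s≤s (unique-⊆⇒length-≤ u (⊆-─ x∈ x≉xs xs⊆ys)))

open Pigeonhole using (unique-⊆⇒length-≤)

─-↭ : {x : A} {xs : List A} (x∈ : x ∈ xs) → x ∷ (xs ─ x∈) ↭ xs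
─-↭ (here refl) = ↭.refl
─-↭ {xs = y ∷ xs} (there x∈) = ↭.trans (↭.swap _ y ↭.refl) (↭.prep y (─-↭ x∈))

unique-⊆⇒↭ : {xs ys : List A} → Unique xs → All (_∈ ys) xs → length ys ≤ length xs → xs ↭ ys
unique-⊆⇒↭ {xs = []}     {[]}    _ _ _ = ↭.refl
unique-⊆⇒↭ {xs = []}     {_ ∷ _} _ _ ()
unique-⊆⇒↭ {A = A} {xs = x ∷ xs} {ys} (x∉xs ∷ u) (x∈ ∷ xs⊆ys) ys≤ =
  ↭.trans (↭.prep x (unique-⊆⇒↭ u (Pigeonhole.⊆-─ (setoid A) x∈ x∉xs xs⊆ys) ys─x≤xs)) (─-↭ x∈)
  where
  ys─x≤xs : length (ys ─ x∈) ≤ length xs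
  ys─x≤xs = ≤-pred (subst (_≤ suc (length xs)) (length-removeAt′ ys (Any.index x∈)) ys≤)

-- Distances along a vertex sequence

Before : Weight → List A → A → A → Set
Before one z u v = ∃₂ λ l r → z ≡ l ++ u ∷ v ∷ r
Before two z u v = ∃₂ λ l m → ∃ λ r → z ≡ l ++ u ∷ m ∷ v ∷ r

AtDistance : Weight → List A → A → A → Set
AtDistance w z u v = Before w z u v ⊎ Before w z v u

Realizes : List A → A × A × Weight → Set
Realizes z (u , v , w) = AtDistance w z u v

before-++ˡ : (p : List A) (w : Weight) {z : List A} {u v : A} → Before w z u v → Before w (p ++ z) u v
before-++ˡ p one (l , r , refl)     = p ++ l , r , sym (++-assoc p l _)
before-++ˡ p two (l , m , r , refl) = p ++ l , m , r , sym (++-assoc p l _)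

before-++ʳ : (q : List A) (w : Weight) {z : List A} {u v : A} → Before w z u v → Before w (z ++ q) u v
before-++ʳ q one {u = u} {v} (l , r , refl)     = l , r ++ q , ++-assoc l (u ∷ v ∷ r) q
before-++ʳ q two {u = u} {v} (l , m , r , refl) = l , m , r ++ q , ++-assoc l (u ∷ m ∷ v ∷ r) q

reverse-++-++ : (l m r : List A) → reverse (l ++ m ++ r) ≡ reverse r ++ reverse m ++ reverse l
reverse-++-++ l m r = trans (reverse-++ l (m ++ r))
  (trans (cong (_++ reverse l) (reverse-++ m r)) (++-assoc (reverse r) (reverse m) (reverse l)))

before-reverse : (w : Weight) {z : List A} {u v : A} → Before w z u v → Before w (reverse z) v u
before-reverse one {u = u} {v} (l , r , refl)     = reverse r , reverse l , reverse-++-++ l (u ∷ v ∷ []) r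
before-reverse two {u = u} {v} (l , m , r , refl) = reverse r , m , reverse l , reverse-++-++ l (u ∷ m ∷ v ∷ []) r

realizes-++ˡ : (p : List A) {z : List A} {e : A × A × Weight} → Realizes z e → Realizes (p ++ z) e
realizes-++ˡ p {e = _ , _ , w} = Sum.map (before-++ˡ p w) (before-++ˡ p w)

realizes-++ʳ : (q : List A) {z : List A} {e : A × A × Weight} → Realizes z e → Realizes (z ++ q) e
realizes-++ʳ q {e = _ , _ , w} = Sum.map (before-++ʳ q w) (before-++ʳ q w)

atDistance-reverse : (w : Weight) {z : List A} {u v : A} → AtDistance w z u v → AtDistance w (reverse z) u v
atDistance-reverse w = Sum.swap ∘ Sum.map (before-reverse w) (before-reverse w)

before₁-before₂ : {z : List A} {u v : A} → Unique z → Before one z u v → Before two z u v → ⊥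
before₁-before₂ uz (l , r , refl) (l′ , m , r′ , eq) with prefix-unique l l′ uz eq
... | refl with unique-++ʳ l uz | ∷-injectiveʳ (∷-injectiveʳ (++-cancelˡ l _ _ eq))
...   | _ ∷ (v∉r ∷ _) | r≡vr′ = All.lookup v∉r (subst (_ ∈_) (sym r≡vr′) (here refl)) refl

before₁-after₂ : {z : List A} {u v : A} → Unique z → Before one z u v → Before two z v u → ⊥
before₁-after₂ {u = u} {v} uz (l , r , refl) (l′ , m , r′ , eq)
  with prefix-unique l (l′ ++ v ∷ m ∷ []) uz (trans eq (sym (++-assoc l′ (v ∷ m ∷ []) (u ∷ r′))))
... | refl with unique-++ʳ l′ (subst Unique (++-assoc l′ (v ∷ m ∷ []) (u ∷ v ∷ r)) uz)
...   | v∉ ∷ _ = All.lookup v∉ (there (there (here refl))) refl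

atDistance₁-atDistance₂ : {z : List A} {u v : A} → Unique z → AtDistance one z u v → AtDistance two z u v → ⊥
atDistance₁-atDistance₂ uz (inj₁ d) (inj₁ d′) = before₁-before₂ uz d d′
atDistance₁-atDistance₂ uz (inj₁ d) (inj₂ d′) = before₁-after₂ uz d d′
atDistance₁-atDistance₂ uz (inj₂ d) (inj₁ d′) = before₁-after₂ uz d d′
atDistance₁-atDistance₂ uz (inj₂ d) (inj₂ d′) = before₁-before₂ uz d d′

atDistance-functional : {z : List A} {u v : A} (w w′ : Weight) → Unique z →
  AtDistance w z u v → AtDistance w′ z u v → w ≡ w′
atDistance-functional one one _  _ _  = refl
atDistance-functional two two _  _ _  = refl
atDistance-functional one two uz d d′ = ⊥-elim (atDistance₁-atDistance₂ uz d d′)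
atDistance-functional two one uz d d′ = ⊥-elim (atDistance₁-atDistance₂ uz d′ d)

-- Z-paths are G-type Hamiltonian paths

-- traverse0 L and traverse1 L are zigzag proj₁ proj₂ (rungs L) and zigzag proj₂ proj₁ (rungs L).
zigzag : {P : Set} (f g : P → A) → List P → List A
zigzag f g = concatMap (λ p → f p ∷ g p ∷ [])

module _ {P : Set} (f g : P → Fin N) where

  zigzag-rungs : (ps : List P) → All (λ p → Realizes (zigzag f g ps) (f p , g p , one)) ps
  zigzag-rungs []       = []
  zigzag-rungs (p ∷ ps) =
    inj₁ ([] , _ , refl) ∷ All.map (λ {q} → realizes-++ˡ (f p ∷ g p ∷ []) {e = f q , g q , one}) (zigzag-rungs ps)

  zigzag-rail₁ : (ps : List P) → All (Realizes (zigzag f g ps)) (pathEdges (map f ps))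
  zigzag-rail₁ []            = []
  zigzag-rail₁ (p ∷ [])      = []
  zigzag-rail₁ (p ∷ p′ ∷ ps) =
    inj₁ ([] , g p , _ , refl) ∷ All.map (realizes-++ˡ (f p ∷ g p ∷ [])) (zigzag-rail₁ (p′ ∷ ps))

  zigzag-rail₂ : (ps : List P) → All (Realizes (zigzag f g ps)) (pathEdges (map g ps))
  zigzag-rail₂ []            = []
  zigzag-rail₂ (p ∷ [])      = []
  zigzag-rail₂ (p ∷ p′ ∷ ps) =
    inj₁ (f p ∷ [] , f p′ , _ , refl) ∷ All.map (realizes-++ˡ (f p ∷ g p ∷ [])) (zigzag-rail₂ (p′ ∷ ps))

  zigzag-swap-↭ : (ps : List P) → zigzag g f ps ↭ zigzag f g ps
  zigzag-swap-↭ []       = ↭.refl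
  zigzag-swap-↭ (p ∷ ps) = ↭.swap (g p) (f p) (zigzag-swap-↭ ps)

traversal-realizes : (L : Ladder N) (b : Fin 2) → All (Realizes (traversal L b)) (ladderEdges L)
traversal-realizes L zero = All.++⁺ (All.map⁺ (zigzag-rungs proj₁ proj₂ (rungs L)))
  (All.++⁺ (zigzag-rail₁ proj₁ proj₂ (rungs L)) (zigzag-rail₂ proj₁ proj₂ (rungs L)))
traversal-realizes L (suc _) = All.++⁺ (All.map⁺ (All.map Sum.swap (zigzag-rungs proj₂ proj₁ (rungs L))))
  (All.++⁺ (zigzag-rail₂ proj₂ proj₁ (rungs L)) (zigzag-rail₁ proj₂ proj₁ (rungs L)))

traversal-↭ : (L : Ladder N) (b : Fin 2) → traversal L b ↭ ladderVertices L
traversal-↭ L zero    = ↭.refl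
traversal-↭ L (suc _) = zigzag-swap-↭ proj₁ proj₂ (rungs L)

interleave-realizes : (x₀ : Fin N) (xs ys : List (Fin N)) → length ys ≡ 2 + length xs →
  All (Realizes (interleaveSeg x₀ ys xs)) (pathEdges xs ++ pathEdges ys)
interleave-realizes x₀ []       (a ∷ b ∷ [])      _ = inj₁ ([] , x₀ , [] , refl) ∷ []
interleave-realizes x₀ (x ∷ []) (y ∷ a ∷ b ∷ [])  _ =
  inj₁ ([] , x , _ , refl) ∷ inj₁ (y ∷ x ∷ [] , x₀ , [] , refl) ∷ []
interleave-realizes x₀ (x ∷ x′ ∷ xs) (y ∷ y′ ∷ ys) e
  with All.++⁻ (pathEdges (x′ ∷ xs)) (interleave-realizes x₀ (x′ ∷ xs) (y′ ∷ ys) (suc-injective e))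
... | xs-edges , ys-edges =
  inj₁ (y ∷ [] , y′ , _ , refl) ∷ All.++⁺ (All.map (realizes-++ˡ (y ∷ x ∷ [])) xs-edges)
    (inj₁ ([] , x , _ , refl) ∷ All.map (realizes-++ˡ (y ∷ x ∷ [])) ys-edges)
interleave-realizes _ []       []                    ()
interleave-realizes _ []       (_ ∷ [])              ()
interleave-realizes _ []       (_ ∷ _ ∷ _ ∷ _)       ()
interleave-realizes _ (_ ∷ _)  []                    ()
interleave-realizes _ (_ ∷ []) (_ ∷ [])              ()
interleave-realizes _ (_ ∷ []) (_ ∷ _ ∷ [])          ()
interleave-realizes _ (_ ∷ []) (_ ∷ _ ∷ _ ∷ _ ∷ _)   ()
interleave-realizes _ (_ ∷ _ ∷ _) (_ ∷ [])           ()

interleave-↭ : (x₀ : Fin N) (xs ys : List (Fin N)) → length ys ≡ 2 + length xs →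
  interleaveSeg x₀ ys xs ↭ x₀ ∷ xs ++ ys
interleave-↭ x₀ []       (a ∷ b ∷ [])     _ = ↭.swap a x₀ ↭.refl
interleave-↭ x₀ (x ∷ xs) (y ∷ ys)         e = begin
  y ∷ x ∷ interleaveSeg x₀ ys xs  ↭⟨ ↭.prep y (↭.prep x (interleave-↭ x₀ xs ys (suc-injective e))) ⟩
  y ∷ x ∷ x₀ ∷ xs ++ ys           ↭⟨ ↭.prep y (↭.swap x x₀ ↭.refl) ⟩
  y ∷ x₀ ∷ x ∷ xs ++ ys           ↭⟨ ↭.swap y x₀ ↭.refl ⟩
  x₀ ∷ y ∷ x ∷ xs ++ ys           ↭⟨ ↭.prep x₀ (↭.swap y x ↭.refl) ⟩
  x₀ ∷ x ∷ y ∷ xs ++ ys           ↭⟨ ↭.prep x₀ (↭.prep x (↭-sym (↭.shift y xs ys))) ⟩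
  x₀ ∷ x ∷ xs ++ y ∷ ys           ∎
  where open ↭.PermutationReasoning
interleave-↭ _ []       []                ()
interleave-↭ _ []       (_ ∷ [])          ()
interleave-↭ _ []       (_ ∷ _ ∷ _ ∷ _)   ()
interleave-↭ _ (_ ∷ _)  []                ()

initialSegment-realizes : (x₀ : Fin N) (R : Residual N) → All (Realizes (initialSegment x₀ R)) (residualEdges R)
initialSegment-realizes x₀ empty             = []
initialSegment-realizes x₀ (edge a b)        = inj₁ ([] , x₀ , [] , refl) ∷ []
initialSegment-realizes x₀ (paths xs ys _ e) = interleave-realizes x₀ xs ys e

initialSegment-↭ : (x₀ : Fin N) (R : Residual N) → initialSegment x₀ R ↭ x₀ ∷ residualVertices R
initialSegment-↭ x₀ empty             = ↭.refl
initialSegment-↭ x₀ (edge a b)        = ↭.swap a x₀ ↭.refl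
initialSegment-↭ x₀ (paths xs ys _ e) = interleave-↭ x₀ xs ys e

continuation-realizes : (Ls : List (Ladder N)) (s : List (Fin 2)) → length s ≡ length Ls →
  All (Realizes (continuation Ls s)) (concatMap ladderEdges Ls)
continuation-realizes []       _       _ = []
continuation-realizes (L ∷ Ls) (b ∷ s) e =
  All.++⁺ (All.map (realizes-++ʳ (continuation Ls s)) (traversal-realizes L b))
          (All.map (realizes-++ˡ (traversal L b)) (continuation-realizes Ls s (suc-injective e)))

continuation-↭ : (Ls : List (Ladder N)) (s : List (Fin 2)) → length s ≡ length Ls →
  continuation Ls s ↭ concatMap ladderVertices Ls
continuation-↭ []       _       _ = ↭.refl
continuation-↭ (L ∷ Ls) (b ∷ s) e = ↭.++⁺ (traversal-↭ L b) (continuation-↭ Ls s (suc-injective e))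

zPath : Laddered N → List (Fin 2) → List (Fin N)
zPath G s = initialSegment (apex G) (residual G) ++ continuation (ladders G) s

GType : Laddered N → List (Fin N) → Set
GType G z = Unique z × All (Realizes z) (edges G)

module _ (G : Laddered N) {s : List (Fin 2)} (s-length : length s ≡ length (ladders G)) where

  zPath-↭ : zPath G s ↭ allFin N
  zPath-↭ = ↭.trans (↭.++⁺ (initialSegment-↭ (apex G) (residual G)) (continuation-↭ (ladders G) s s-length))
                    (partition G)

  zPath-unique : Unique (zPath G s)
  zPath-unique = unique-resp-↭ (↭-sym zPath-↭) (allFin⁺ N)

  zPath-gType : GType G (zPath G s)
  zPath-gType = zPath-unique , All.++⁺
    (All.map (realizes-++ʳ (continuation (ladders G) s)) (initialSegment-realizes (apex G) (residual G)))
    (All.map (realizes-++ˡ (initialSegment (apex G) (residual G))) (continuation-realizes (ladders G) s s-length))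

-- Distinctness of the produced paths

allPairs-weaken : {P : A → Set} {R S : A → A → Set} {xs : List A} →
  (∀ {x y} → P x → P y → R x y → S x y) → All P xs → AllPairs R xs → AllPairs S xs
allPairs-weaken h []         []         = []
allPairs-weaken h (px ∷ pxs) (rx ∷ rxs) =
  All.zipWith (λ (py , rxy) → h px py rxy) (pxs , rx) ∷ allPairs-weaken h pxs rxs

allPairs-concatMap : {f : A → List B} {R : A → A → Set} {S : B → B → Set} {xs : List A} →
  AllPairs R xs → All (λ x → AllPairs S (f x)) xs →
  (∀ {x y} → R x y → All (λ a → All (S a) (f y)) (f x)) → AllPairs S (concatMap f xs)
allPairs-concatMap r s across = AllPairs.concat⁺ (All.map⁺ s) (AllPairs.map⁺ (AllPairs.map across r))

length-concatMap-pairs : {f : A → List B} → (∀ x → length (f x) ≡ 2) → (xs : List A) →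
  length (concatMap f xs) ≡ 2 * length xs
length-concatMap-pairs f₂ []       = refl
length-concatMap-pairs {f = f} f₂ (x ∷ xs) = trans (length-++ (f x))
  (trans (cong₂ _+_ (f₂ x) (length-concatMap-pairs f₂ xs)) (sym (*-suc 2 (length xs))))

binarySeqs-length : (l : ℕ) → All (λ s → length s ≡ l) (binarySeqs l)
binarySeqs-length zero    = refl ∷ []
binarySeqs-length (suc l) =
  All.concat⁺ (All.map⁺ (All.map (λ e → cong suc e ∷ cong suc e ∷ []) (binarySeqs-length l)))

∷-≢ʳ : {x y : A} {xs ys : List A} → xs ≢ ys → x ∷ xs ≢ y ∷ ys
∷-≢ʳ xs≢ys = xs≢ys ∘ ∷-injectiveʳ

binarySeqs-unique : (l : ℕ) → Unique (binarySeqs l)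
binarySeqs-unique zero    = [] ∷ []
binarySeqs-unique (suc l) = allPairs-concatMap (binarySeqs-unique l)
  (All.tabulate (λ _ → ((λ ()) ∷ []) ∷ [] ∷ []))
  (λ s≢s′ → (∷-≢ʳ s≢s′ ∷ ∷-≢ʳ s≢s′ ∷ [])
          ∷ (∷-≢ʳ s≢s′ ∷ ∷-≢ʳ s≢s′ ∷ []) ∷ [])

length-binarySeqs : (l : ℕ) → length (binarySeqs l) ≡ 2 ^ l
length-binarySeqs zero    = refl
length-binarySeqs (suc l) =
  trans (length-concatMap-pairs (λ _ → refl) (binarySeqs l)) (cong (2 *_) (length-binarySeqs l))

samePath-sym : {p q : List (Fin N)} → SamePath p q → SamePath q p
samePath-sym         (inj₁ p≡q)  = inj₁ (sym p≡q)
samePath-sym {q = q} (inj₂ p≡q˘) = inj₂ (trans (sym (reverse-involutive q)) (cong reverse (sym p≡q˘)))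

samePath-trans : {p q r : List (Fin N)} → SamePath p q → SamePath q r → SamePath p r
samePath-trans         (inj₁ p≡q)  (inj₁ q≡r)  = inj₁ (trans p≡q q≡r)
samePath-trans         (inj₁ p≡q)  (inj₂ q≡r˘) = inj₂ (trans p≡q q≡r˘)
samePath-trans         (inj₂ p≡q˘) (inj₁ q≡r)  = inj₂ (trans p≡q˘ (cong reverse q≡r))
samePath-trans {r = r} (inj₂ p≡q˘) (inj₂ q≡r˘) =
  inj₁ (trans p≡q˘ (trans (cong reverse q≡r˘) (reverse-involutive r)))

samePath-setoid : ℕ → Setoid _ _
samePath-setoid N = record
  { Carrier       = List (Fin N)
  ; _≈_           = SamePath
  ; isEquivalence = record { refl = inj₁ refl ; sym = samePath-sym ; trans = samePath-trans }
  }

edgeIn-atDistance : (G : Laddered N) {z : List (Fin N)} {u v : Fin N} {w : Weight} →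
  All (Realizes z) (edges G) → EdgeIn G u v w → AtDistance w z u v
edgeIn-atDistance G realized (inj₁ uv∈) = All.lookup realized uv∈
edgeIn-atDistance G realized (inj₂ vu∈) = Sum.swap (All.lookup realized vu∈)

compatible⇒¬samePath : {G H : Laddered N} {z z′ : List (Fin N)} →
  Compatible G H → GType G z → GType H z′ → ¬ SamePath z z′
compatible⇒¬samePath {G = G} {H} (u , v , w , w′ , uv∈G , uv∈H , w≢w′)
  (z-unique , z-realizes) (_ , z′-realizes) same =
  w≢w′ (atDistance-functional w w′ z-unique (edgeIn-atDistance G z-realizes uv∈G) (transport same))
  where
  transport : {z : List (Fin _)} → SamePath z _ → AtDistance w′ z u v
  transport (inj₁ refl) = edgeIn-atDistance H z′-realizes uv∈H
  transport (inj₂ refl) = atDistance-reverse w′ (edgeIn-atDistance H z′-realizes uv∈H)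

traversal-cancel : (L : Ladder N) (b b′ : Fin 2) {xs ys : List (Fin N)} →
  Unique (traversal L b ++ xs) → traversal L b ++ xs ≡ traversal L b′ ++ ys → b ≡ b′ × xs ≡ ys
traversal-cancel L            zero       zero       _                 eq = refl , ++-cancelˡ (traverse0 L) _ _ eq
traversal-cancel L            (suc zero) (suc zero) _                 eq = refl , ++-cancelˡ (traverse1 L) _ _ eq
traversal-cancel (ladder _ _) zero       (suc zero) ((v≢w ∷ _) ∷ _) eq = ⊥-elim (v≢w (∷-injectiveˡ eq))
traversal-cancel (ladder _ _) (suc zero) zero       ((w≢v ∷ _) ∷ _) eq = ⊥-elim (w≢v (∷-injectiveˡ eq))

continuation-injective : (Ls : List (Ladder N)) {s s′ : List (Fin 2)} →
  length s ≡ length Ls → length s′ ≡ length Ls →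
  Unique (continuation Ls s) → continuation Ls s ≡ continuation Ls s′ → s ≡ s′
continuation-injective []       {[]}    {[]}     _ _  _ _  = refl
continuation-injective (L ∷ Ls) {b ∷ s} {b′ ∷ s′} e e′ u eq with traversal-cancel L b b′ u eq
... | refl , eq′ =
  cong (b ∷_) (continuation-injective Ls (suc-injective e) (suc-injective e′) (unique-++ʳ (traversal L b) u) eq′)
continuation-injective []       {[]}    {_ ∷ _}  _ () _ _
continuation-injective []       {_ ∷ _}          () _ _ _
continuation-injective (_ ∷ _)  {[]}             () _ _ _
continuation-injective (_ ∷ _)  {_ ∷ _} {[]}     _ () _ _

continuation-≢[] : (Ls : List (Ladder N)) {s : List (Fin 2)} → length s ≡ length Ls →
  s ≢ [] → continuation Ls s ≢ []
continuation-≢[] []                 {[]}           _  s≢[] = ⊥-elim (s≢[] refl)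
continuation-≢[] (ladder _ _ ∷ _)  {zero ∷ _}     _  _    = λ ()
continuation-≢[] (ladder _ _ ∷ _)  {suc zero ∷ _} _  _    = λ ()
continuation-≢[] []                 {_ ∷ _}        ()
continuation-≢[] (_ ∷ _)            {[]}           ()

initialSegment-≢[] : (x₀ : Fin N) (R : Residual N) → initialSegment x₀ R ≢ []
initialSegment-≢[] x₀ R eq =
  ↭.¬x∷xs↭[] (↭-sym (subst (_↭ x₀ ∷ residualVertices R) eq (initialSegment-↭ x₀ R)))

zPath-distinct : (G : Laddered N) {s s′ : List (Fin 2)} →
  length s ≡ length (ladders G) → length s′ ≡ length (ladders G) → s ≢ s′ → ¬ SamePath (zPath G s) (zPath G s′)
zPath-distinct G e e′ s≢s′ (inj₁ eq) = s≢s′ (continuation-injective (ladders G) e e′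
  (unique-++ʳ (initialSegment (apex G) (residual G)) (zPath-unique G e))
  (++-cancelˡ (initialSegment (apex G) (residual G)) _ _ eq))
zPath-distinct G {[]}    {[]}     e e′ s≢s′ (inj₂ _)  = s≢s′ refl
zPath-distinct G {_ ∷ _} {[]}     e e′ s≢s′ (inj₂ _)  with trans e (sym e′)
... | ()
zPath-distinct G {s}     {s′@(_ ∷ _)} e e′ s≢s′ (inj₂ eq) =
  prefix-not-reverse (initialSegment (apex G) (residual G)) (continuation (ladders G) s) (continuation (ladders G) s′)
    (initialSegment-≢[] (apex G) (residual G)) (continuation-≢[] (ladders G) e′ λ ()) (zPath-unique G e′) eq

zPaths-gType : (G : Laddered N) → All (GType G) (zPaths G)
zPaths-gType G = All.map⁺ (All.map (zPath-gType G) (binarySeqs-length (length (ladders G))))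

zPaths-distinct : (G : Laddered N) → AllPairs (λ z z′ → ¬ SamePath z z′) (zPaths G)
zPaths-distinct G = AllPairs.map⁺
  (allPairs-weaken (zPath-distinct G) (binarySeqs-length (length (ladders G))) (binarySeqs-unique (length (ladders G))))

zPathsFamily-distinct : (F : List (Laddered N)) → CompatibleFamily F →
  AllPairs (λ z z′ → ¬ SamePath z z′) (zPathsFamily F)
zPathsFamily-distinct F compatible = allPairs-concatMap compatible (All.tabulate (λ {G} _ → zPaths-distinct G))
  (λ {G} {H} G~H → All.map (λ z-G → All.map (compatible⇒¬samePath {G = G} {H} G~H z-G) (zPaths-gType H))
                           (zPaths-gType G))

yieldsPaths⇒length : (F : List (Laddered N)) {c : ℕ} → CompatibleFamily F → YieldsPaths F c →
  length (zPathsFamily F) ≡ c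
yieldsPaths⇒length {N} F compatible (P , |P|≡c , P-distinct , P⊆Z , Z⊆P) = trans
  (≤-antisym (unique-⊆⇒length-≤ (samePath-setoid N) (zPathsFamily-distinct F compatible) Z⊆P)
             (unique-⊆⇒length-≤ (samePath-setoid N) P-distinct P⊆Z))
  |P|≡c

yieldsPaths-length : (F : List (Laddered N)) → CompatibleFamily F → YieldsPaths F (length (zPathsFamily F))
yieldsPaths-length F compatible = zPathsFamily F , refl , zPathsFamily-distinct F compatible , ⊆-refl , ⊆-refl
  where
  ⊆-refl : All (λ p → Any (SamePath p) (zPathsFamily F)) (zPathsFamily F)
  ⊆-refl = All.tabulate (Any.map inj₁)

-- Counting

∑ : List A → (A → ℕ) → ℕ
∑ []       g = 0
∑ (x ∷ xs) g = g x + ∑ xs g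

∑-++ : (xs ys : List A) (g : A → ℕ) → ∑ (xs ++ ys) g ≡ ∑ xs g + ∑ ys g
∑-++ []       ys g = refl
∑-++ (x ∷ xs) ys g = trans (cong (g x +_) (∑-++ xs ys g)) (sym (+-assoc (g x) _ _))

∑-map : (h : B → A) (xs : List B) (g : A → ℕ) → ∑ (map h xs) g ≡ ∑ xs (g ∘ h)
∑-map h []       g = refl
∑-map h (x ∷ xs) g = cong (g (h x) +_) (∑-map h xs g)

∑-cong : (xs : List A) {g h : A → ℕ} → (∀ x → g x ≡ h x) → ∑ xs g ≡ ∑ xs h
∑-cong []       g≗h = refl
∑-cong (x ∷ xs) g≗h = cong₂ _+_ (g≗h x) (∑-cong xs g≗h)

∑-+ : (xs : List A) (g h : A → ℕ) → ∑ xs (λ x → g x + h x) ≡ ∑ xs g + ∑ xs h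
∑-+ []       g h = refl
∑-+ (x ∷ xs) g h = trans (cong (g x + h x +_) (∑-+ xs g h)) (interchange (g x) (h x) (∑ xs g) (∑ xs h))
  where
  interchange : ∀ a b c d → a + b + (c + d) ≡ a + c + (b + d)
  interchange = solve-∀

∑-*ˡ : (c : ℕ) (xs : List A) (g : A → ℕ) → ∑ xs (λ x → c * g x) ≡ c * ∑ xs g
∑-*ˡ c []       g = sym (*-zeroʳ c)
∑-*ˡ c (x ∷ xs) g = trans (cong (c * g x +_) (∑-*ˡ c xs g)) (sym (*-distribˡ-+ c (g x) _))

length-zPaths : (G : Laddered N) → length (zPaths G) ≡ 2 ^ length (ladders G)
length-zPaths G = trans (length-map _ (binarySeqs (length (ladders G)))) (length-binarySeqs (length (ladders G)))

length-zPathsFamily-++ : (F F′ : List (Laddered N)) →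
  length (zPathsFamily (F ++ F′)) ≡ length (zPathsFamily F) + length (zPathsFamily F′)
length-zPathsFamily-++ F F′ = trans (cong length (concatMap-++ zPaths F F′)) (length-++ (zPathsFamily F))

length-zPathsFamily-map : {h : Laddered K → Laddered N} (c : ℕ) →
  (∀ G → length (zPaths (h G)) ≡ c * length (zPaths G)) →
  (F : List (Laddered K)) → length (zPathsFamily (map h F)) ≡ c * length (zPathsFamily F)
length-zPathsFamily-map c scaled []      = sym (*-zeroʳ c)
length-zPathsFamily-map {h = h} c scaled (G ∷ F) = begin
  length (zPaths (h G) ++ zPathsFamily (map h F))
    ≡⟨ length-++ (zPaths (h G)) ⟩
  length (zPaths (h G)) + length (zPathsFamily (map h F))
    ≡⟨ cong₂ _+_ (scaled G) (length-zPathsFamily-map c scaled F) ⟩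
  c * length (zPaths G) + c * length (zPathsFamily F)
    ≡⟨ sym (*-distribˡ-+ c _ _) ⟩
  c * (length (zPaths G) + length (zPathsFamily F))
    ≡⟨ cong (c *_) (sym (length-++ (zPaths G))) ⟩
  c * length (zPathsFamily (G ∷ F)) ∎
  where open ≡-Reasoning

length-zPathsFamily-concatMap : (g : A → List (Laddered N)) (xs : List A) →
  length (zPathsFamily (concatMap g xs)) ≡ ∑ xs (λ x → length (zPathsFamily (g x)))
length-zPathsFamily-concatMap g []       = refl
length-zPathsFamily-concatMap g (x ∷ xs) =
  trans (length-zPathsFamily-++ (g x) (concatMap g xs)) (cong (_ +_) (length-zPathsFamily-concatMap g xs))

shift : (ℕ → ℕ) → ℕ → ℕ
shift g zero    = 0
shift g (suc m) = g m

shift-cong : {g h : ℕ → ℕ} → (∀ k → g k ≡ h k) → ∀ m → shift g m ≡ shift h m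
shift-cong g≗h zero    = refl
shift-cong g≗h (suc m) = g≗h m

shift-+ : (g h : ℕ → ℕ) (m : ℕ) → shift (λ k → g k + h k) m ≡ shift g m + shift h m
shift-+ g h zero    = refl
shift-+ g h (suc m) = refl

shift-*ˡ : (c : ℕ) (g : ℕ → ℕ) (m : ℕ) → shift (λ k → c * g k) m ≡ c * shift g m
shift-*ˡ c g zero    = sym (*-zeroʳ c)
shift-*ˡ c g (suc m) = refl

∑-shift : (xs : List A) (g : A → ℕ → ℕ) (m : ℕ) →
  ∑ xs (λ x → shift (g x) m) ≡ shift (λ k → ∑ xs (λ x → g x k)) m
∑-shift []       g zero    = refl
∑-shift []       g (suc m) = refl
∑-shift (x ∷ xs) g zero    = ∑-shift xs g zero
∑-shift (x ∷ xs) g (suc m) = refl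

shift²-half : (g : ℕ → ℕ) (m : ℕ) → shift (shift (λ k → g ⌊ k /2⌋)) m ≡ shift g ⌊ m /2⌋
shift²-half g zero          = refl
shift²-half g (suc zero)    = refl
shift²-half g (suc (suc m)) = refl

pascal : (n m : ℕ) → suc n C m ≡ n C m + shift (n C_) m
pascal n zero    = refl
pascal n (suc m) = trans (sym (nCk+nC[k+1]≡[n+1]C[k+1] n m)) (+-comm (n C m) (n C suc m))

pascal² : (n m : ℕ) → suc (suc n) C m ≡ n C m + shift (shift (n C_)) m + 2 * shift (n C_) m
pascal² n m = begin
  suc (suc n) C m
    ≡⟨ pascal (suc n) m ⟩
  suc n C m + shift (suc n C_) m
    ≡⟨ cong₂ _+_ (pascal n m) (shift-cong (pascal n) m) ⟩
  n C m + shift (n C_) m + shift (λ k → n C k + shift (n C_) k) m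
    ≡⟨ cong (n C m + shift (n C_) m +_) (shift-+ (n C_) (shift (n C_)) m) ⟩
  n C m + shift (n C_) m + (shift (n C_) m + shift (shift (n C_)) m)
    ≡⟨ regroup (n C m) (shift (n C_) m) (shift (shift (n C_)) m) ⟩
  n C m + shift (shift (n C_)) m + 2 * shift (n C_) m ∎
  where
  open ≡-Reasoning
  regroup : ∀ a b c → a + b + (b + c) ≡ a + c + 2 * b
  regroup = solve-∀

-- The coefficient of xᵐ in (2x)ᶠ (1 + x) (1 + x²)ᵗ.
coefficient : ℕ → ℕ → ℕ → ℕ
coefficient zero    t m = t C ⌊ m /2⌋
coefficient (suc f) t m = 2 * shift (coefficient f t) m

coefficient-sucᵗ : (f t m : ℕ) →
  coefficient f (suc t) m ≡ coefficient f t m + shift (shift (coefficient f t)) m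
coefficient-sucᵗ zero    t m = trans (pascal t ⌊ m /2⌋) (cong (t C ⌊ m /2⌋ +_) (sym (shift²-half (t C_) m)))
coefficient-sucᵗ (suc f) t m = begin
  2 * shift (coefficient f (suc t)) m
    ≡⟨ cong (2 *_) (shift-cong (coefficient-sucᵗ f t) m) ⟩
  2 * shift (λ k → c k + shift (shift c) k) m
    ≡⟨ cong (2 *_) (shift-+ c (shift (shift c)) m) ⟩
  2 * (shift c m + shift (shift (shift c)) m)
    ≡⟨ *-distribˡ-+ 2 (shift c m) _ ⟩
  2 * shift c m + 2 * shift (shift (shift c)) m
    ≡⟨ cong (2 * shift c m +_) (sym (trans (shift-cong (shift-*ˡ 2 (shift c)) m)
                                          (shift-*ˡ 2 (shift (shift c)) m))) ⟩
  2 * shift c m + shift (shift (λ k → 2 * shift c k)) m ∎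
  where
  open ≡-Reasoning
  c : ℕ → ℕ
  c = coefficient f t

coefficient-top : (f t : ℕ) → coefficient f t (f + t) ≡ 2 ^ f * (t C ⌊ t /2⌋)
coefficient-top zero    t = sym (+-identityʳ _)
coefficient-top (suc f) t = trans (cong (2 *_) (coefficient-top f t)) (sym (*-assoc 2 (2 ^ f) _))

boolVecs : (n : ℕ) → List (Vec Bool n)
boolVecs zero    = [] ∷ []
boolVecs (suc n) = map (true ∷_) (boolVecs n) ++ map (false ∷_) (boolVecs n)

trues falses : {n : ℕ} → Vec Bool n → ℕ
trues []           = 0
trues (true ∷ s)   = suc (trues s)
trues (false ∷ s)  = trues s
falses []          = 0
falses (true ∷ s)  = falses s
falses (false ∷ s) = suc (falses s)

falses+trues : {n : ℕ} (s : Vec Bool n) → falses s + trues s ≡ n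
falses+trues []          = refl
falses+trues (true ∷ s)  = trans (+-suc (falses s) (trues s)) (cong suc (falses+trues s))
falses+trues (false ∷ s) = cong suc (falses+trues s)

∑-boolVecs : (n : ℕ) (g : Vec Bool (suc n) → ℕ) →
  ∑ (boolVecs (suc n)) g ≡ ∑ (boolVecs n) (λ s → g (true ∷ s)) + ∑ (boolVecs n) (λ s → g (false ∷ s))
∑-boolVecs n g = trans (∑-++ (map (true ∷_) (boolVecs n)) _ g)
  (cong₂ _+_ (∑-map (true ∷_) (boolVecs n) g) (∑-map (false ∷_) (boolVecs n) g))

-- (1+x)^(2n+1) = (1+x)(2x + (1 + x²))ⁿ, where s chooses 2x (false) or 1 + x² (true) in each factor.
∑-coefficient : (n m : ℕ) → ∑ (boolVecs n) (λ s → coefficient (falses s) (trues s) m) ≡ suc (2 * n) C m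
∑-coefficient zero zero          = refl
∑-coefficient zero (suc zero)    = refl
∑-coefficient zero (suc (suc m)) = refl
∑-coefficient (suc n) m = begin
  ∑ (boolVecs (suc n)) (λ s → coefficient (falses s) (trues s) m)
    ≡⟨ ∑-boolVecs n (λ s → coefficient (falses s) (trues s) m) ⟩
  ∑ vs (λ s → coefficient (falses s) (suc (trues s)) m) + ∑ vs (λ s → 2 * shift (c s) m)
    ≡⟨ cong₂ _+_ (∑-cong vs (λ s → coefficient-sucᵗ (falses s) (trues s) m))
                 (∑-*ˡ 2 vs (λ s → shift (c s) m)) ⟩
  ∑ vs (λ s → c s m + shift (shift (c s)) m) + 2 * ∑ vs (λ s → shift (c s) m)
    ≡⟨ cong (_+ 2 * ∑ vs (λ s → shift (c s) m)) (∑-+ vs (λ s → c s m) (λ s → shift (shift (c s)) m)) ⟩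
  S m + ∑ vs (λ s → shift (shift (c s)) m) + 2 * ∑ vs (λ s → shift (c s) m)
    ≡⟨ cong₂ (λ a b → S m + a + 2 * b)
         (trans (∑-shift vs (shift ∘ c) m) (shift-cong (∑-shift vs c) m)) (∑-shift vs c m) ⟩
  S m + shift (shift S) m + 2 * shift S m
    ≡⟨ cong₂ (λ a b → a + b + 2 * shift S m) (∑-coefficient n m)
                                             (shift-cong (shift-cong (∑-coefficient n)) m) ⟩
  n′ C m + shift (shift (n′ C_)) m + 2 * shift S m
    ≡⟨ cong (λ a → n′ C m + shift (shift (n′ C_)) m + 2 * a) (shift-cong (∑-coefficient n) m) ⟩
  n′ C m + shift (shift (n′ C_)) m + 2 * shift (n′ C_) m
    ≡⟨ sym (pascal² n′ m) ⟩
  suc (suc n′) C m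
    ≡⟨ cong (λ k → suc k C m) (sym (*-suc 2 n)) ⟩
  suc (2 * suc n) C m ∎
  where
  open ≡-Reasoning
  n′ : ℕ
  n′ = suc (2 * n)
  vs : List (Vec Bool n)
  vs = boolVecs n
  c : Vec Bool n → ℕ → ℕ
  c s = coefficient (falses s) (trues s)
  S : ℕ → ℕ
  S k = ∑ vs (λ s → c s k)

central-binomial-sum : (n : ℕ) →
  ∑ (boolVecs n) (λ s → 2 ^ falses s * (trues s C ⌊ trues s /2⌋)) ≡ suc (2 * n) C n
central-binomial-sum n = trans
  (∑-cong (boolVecs n) (λ s → trans (sym (coefficient-top (falses s) (trues s)))
                                     (cong (coefficient (falses s) (trues s)) (falses+trues s))))
  (∑-coefficient n n)

-- Relabelling and extending laddered graphs

map-∘-comm : {C D : Set} {f : B → C} {g : A → B} {h : D → C} {k : A → D} →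
  (∀ x → f (g x) ≡ h (k x)) → (xs : List A) → map f (map g xs) ≡ map h (map k xs)
map-∘-comm fg≗hk xs = trans (sym (map-∘ xs)) (trans (map-cong fg≗hk xs) (map-∘ xs))

concatMap-map-natural : {C D : Set} {g : A → List B} {g′ : C → List D} {h : A → C} (φ : B → D) →
  (∀ x → g′ (h x) ≡ map φ (g x)) → (xs : List A) → concatMap g′ (map h xs) ≡ map φ (concatMap g xs)
concatMap-map-natural {g = g} {g′} {h} φ natural xs =
  trans (concatMap-map g′ h xs) (trans (concatMap-cong natural xs) (sym (map-concatMap φ g xs)))

pairList : A × A → List A
pairList (a , b) = a ∷ b ∷ []

flatten : List (A × A) → List A
flatten = concatMap pairList

flatten-injective : (ps qs : List (A × A)) → flatten ps ≡ flatten qs → ps ≡ qs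
flatten-injective []       []       _  = refl
flatten-injective (p ∷ ps) (q ∷ qs) eq = cong₂ _∷_
  (cong₂ _,_ (∷-injectiveˡ eq) (∷-injectiveˡ (∷-injectiveʳ eq)))
  (flatten-injective ps qs (∷-injectiveʳ (∷-injectiveʳ eq)))

rungEdge : Fin N × Fin N → WEdge N
rungEdge (v , w) = v , w , one

layout : Fin N → Residual N → List (Ladder N) → List (Fin N)
layout x₀ R Ls = x₀ ∷ residualVertices R ++ concatMap ladderVertices Ls

module Relabel {K N : ℕ} (φ : Fin K → Fin N) where

  φ² : Fin K × Fin K → Fin N × Fin N
  φ² (u , v) = φ u , φ v

  φᵉ : WEdge K → WEdge N
  φᵉ (u , v , w) = φ u , φ v , w

  relabelResidual : Residual K → Residual N
  relabelResidual empty               = empty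
  relabelResidual (edge a b)          = edge (φ a) (φ b)
  relabelResidual (paths xs ys 1≤ e) = paths (map φ xs) (map φ ys)
    (subst (1 ≤_) (sym (length-map φ xs)) 1≤)
    (trans (length-map φ ys) (trans e (cong (2 +_) (sym (length-map φ xs)))))

  relabelLadder : Ladder K → Ladder N
  relabelLadder (ladder r rs) = ladder (φ² r) (map φ² rs)

  residualVertices-relabel : (R : Residual K) → residualVertices (relabelResidual R) ≡ map φ (residualVertices R)
  residualVertices-relabel empty             = refl
  residualVertices-relabel (edge a b)        = refl
  residualVertices-relabel (paths xs ys _ _) = sym (map-++ φ xs ys)

  ladderVertices-relabel : (L : Ladder K) → ladderVertices (relabelLadder L) ≡ map φ (ladderVertices L)
  ladderVertices-relabel L = concatMap-map-natural {g = pairList} {pairList} {φ²} φ (λ _ → refl) (rungs L)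

  layout-relabel : (x₀ : Fin K) (R : Residual K) (Ls : List (Ladder K)) (extra : List (Ladder N)) →
    layout (φ x₀) (relabelResidual R) (map relabelLadder Ls ++ extra)
      ≡ map φ (layout x₀ R Ls) ++ concatMap ladderVertices extra
  layout-relabel x₀ R Ls extra = cong (φ x₀ ∷_) (begin
    residualVertices (relabelResidual R) ++ concatMap ladderVertices (map relabelLadder Ls ++ extra)
      ≡⟨ cong₂ _++_ (residualVertices-relabel R)
           (trans (concatMap-++ ladderVertices (map relabelLadder Ls) extra)
                  (cong (_++ concatMap ladderVertices extra) (concatMap-map-natural φ ladderVertices-relabel Ls))) ⟩
    map φ (residualVertices R) ++ map φ (concatMap ladderVertices Ls) ++ concatMap ladderVertices extra
      ≡⟨ sym (++-assoc (map φ (residualVertices R)) _ _) ⟩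
    (map φ (residualVertices R) ++ map φ (concatMap ladderVertices Ls)) ++ concatMap ladderVertices extra
      ≡⟨ cong (_++ concatMap ladderVertices extra) (sym (map-++ φ (residualVertices R) _)) ⟩
    map φ (residualVertices R ++ concatMap ladderVertices Ls) ++ concatMap ladderVertices extra ∎)
    where open ≡-Reasoning

  pathEdges-relabel : (xs : List (Fin K)) → pathEdges (map φ xs) ≡ map φᵉ (pathEdges xs)
  pathEdges-relabel []           = refl
  pathEdges-relabel (a ∷ [])     = refl
  pathEdges-relabel (a ∷ b ∷ xs) = cong (φᵉ (a , b , two) ∷_) (pathEdges-relabel (b ∷ xs))

  residualEdges-relabel : (R : Residual K) → residualEdges (relabelResidual R) ≡ map φᵉ (residualEdges R)
  residualEdges-relabel empty             = refl
  residualEdges-relabel (edge a b)        = refl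
  residualEdges-relabel (paths xs ys _ _) =
    trans (cong₂ _++_ (pathEdges-relabel xs) (pathEdges-relabel ys)) (sym (map-++ φᵉ (pathEdges xs) _))

  ladderEdges-relabel : (L : Ladder K) → ladderEdges (relabelLadder L) ≡ map φᵉ (ladderEdges L)
  ladderEdges-relabel L = begin
    map rungEdge (map φ² rs) ++ pathEdges (map proj₁ (map φ² rs)) ++ pathEdges (map proj₂ (map φ² rs))
      ≡⟨ cong₂ _++_ (map-∘-comm {f = rungEdge} {φ²} {φᵉ} {rungEdge} (λ _ → refl) rs)
                    (cong₂ _++_ rail₁ rail₂) ⟩
    map φᵉ (map rungEdge rs) ++ map φᵉ (pathEdges (map proj₁ rs)) ++ map φᵉ (pathEdges (map proj₂ rs))
      ≡⟨ cong (map φᵉ (map rungEdge rs) ++_) (sym (map-++ φᵉ (pathEdges (map proj₁ rs)) _)) ⟩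
    map φᵉ (map rungEdge rs) ++ map φᵉ (pathEdges (map proj₁ rs) ++ pathEdges (map proj₂ rs))
      ≡⟨ sym (map-++ φᵉ (map rungEdge rs) _) ⟩
    map φᵉ (ladderEdges L) ∎
    where
    open ≡-Reasoning
    rs : List (Fin K × Fin K)
    rs = rungs L
    rail₁ : pathEdges (map proj₁ (map φ² rs)) ≡ map φᵉ (pathEdges (map proj₁ rs))
    rail₁ = trans (cong pathEdges (map-∘-comm {f = proj₁} {φ²} {φ} {proj₁} (λ _ → refl) rs))
                  (pathEdges-relabel (map proj₁ rs))
    rail₂ : pathEdges (map proj₂ (map φ² rs)) ≡ map φᵉ (pathEdges (map proj₂ rs))
    rail₂ = trans (cong pathEdges (map-∘-comm {f = proj₂} {φ²} {φ} {proj₂} (λ _ → refl) rs))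
                  (pathEdges-relabel (map proj₂ rs))

  extend : (G : Laddered K) (extra : List (Ladder N)) →
    map φ (allFin K) ++ concatMap ladderVertices extra ↭ allFin N → Laddered N
  extend G extra cover = laddered (φ (apex G)) (relabelResidual (residual G)) (map relabelLadder (ladders G) ++ extra)
    (subst (_↭ allFin N) (sym (layout-relabel (apex G) (residual G) (ladders G) extra))
      (↭.trans (↭.++⁺ʳ _ (↭.map⁺ φ (partition G))) cover))

  module Extend (extra : List (Ladder N)) (cover : map φ (allFin K) ++ concatMap ladderVertices extra ↭ allFin N) where

    edges-extend : (G : Laddered K) → edges (extend G extra cover) ≡ map φᵉ (edges G) ++ concatMap ladderEdges extra
    edges-extend G = begin
      residualEdges (relabelResidual (residual G)) ++ concatMap ladderEdges (map relabelLadder (ladders G) ++ extra)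
        ≡⟨ cong₂ _++_ (residualEdges-relabel (residual G))
             (trans (concatMap-++ ladderEdges (map relabelLadder (ladders G)) extra)
                    (cong (_++ concatMap ladderEdges extra) (concatMap-map-natural φᵉ ladderEdges-relabel (ladders G)))) ⟩
      map φᵉ (residualEdges (residual G)) ++ map φᵉ (concatMap ladderEdges (ladders G)) ++ concatMap ladderEdges extra
        ≡⟨ sym (++-assoc (map φᵉ (residualEdges (residual G))) _ _) ⟩
      (map φᵉ (residualEdges (residual G)) ++ map φᵉ (concatMap ladderEdges (ladders G))) ++ concatMap ladderEdges extra
        ≡⟨ cong (_++ concatMap ladderEdges extra) (sym (map-++ φᵉ (residualEdges (residual G)) _)) ⟩
      map φᵉ (edges G) ++ concatMap ladderEdges extra ∎
      where open ≡-Reasoning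

    edgeIn-extend : (G : Laddered K) {u v : Fin K} {w : Weight} →
      EdgeIn G u v w → EdgeIn (extend G extra cover) (φ u) (φ v) w
    edgeIn-extend G = Sum.map lift lift
      where
      lift : {e : WEdge K} → e ∈ edges G → φᵉ e ∈ edges (extend G extra cover)
      lift e∈ = subst (_ ∈_) (sym (edges-extend G)) (∈-++⁺ˡ (∈-map⁺ φᵉ e∈))

    edgeIn-extend-extra : (G : Laddered K) {u v : Fin N} {w : Weight} →
      (u , v , w) ∈ concatMap ladderEdges extra → EdgeIn (extend G extra cover) u v w
    edgeIn-extend-extra G e∈ = inj₁ (subst (_ ∈_) (sym (edges-extend G)) (∈-++⁺ʳ (map φᵉ (edges G)) e∈))

    compatible-extend : {G H : Laddered K} → Compatible G H → Compatible (extend G extra cover) (extend H extra cover)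
    compatible-extend {G} {H} (u , v , w , w′ , uv∈G , uv∈H , w≢w′) =
      φ u , φ v , w , w′ , edgeIn-extend G uv∈G , edgeIn-extend H uv∈H , w≢w′

    length-zPaths-extend : (G : Laddered K) →
      length (zPaths (extend G extra cover)) ≡ 2 ^ length extra * length (zPaths G)
    length-zPaths-extend G = begin
      length (zPaths (extend G extra cover))
        ≡⟨ length-zPaths (extend G extra cover) ⟩
      2 ^ length (map relabelLadder (ladders G) ++ extra)
        ≡⟨ cong (2 ^_) (trans (length-++ (map relabelLadder (ladders G)))
                              (cong (_+ length extra) (length-map relabelLadder (ladders G)))) ⟩
      2 ^ (length (ladders G) + length extra)
        ≡⟨ trans (^-distribˡ-+-* 2 (length (ladders G)) (length extra)) (*-comm (2 ^ length (ladders G)) _) ⟩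
      2 ^ length extra * 2 ^ length (ladders G)
        ≡⟨ cong (2 ^ length extra *_) (sym (length-zPaths G)) ⟩
      2 ^ length extra * length (zPaths G) ∎
      where open ≡-Reasoning

-- Completing a matching, and choosing pairs

unique-length⇒↭-allFin : {xs : List (Fin N)} → Unique xs → length xs ≡ N → xs ↭ allFin N
unique-length⇒↭-allFin {N} u |xs| =
  unique-⊆⇒↭ u (All.tabulate (λ {x} _ → ∈-allFin x)) (≤-reflexive (trans (length-tabulate id) (sym |xs|)))

missing-vertex : (xs : List (Fin N)) → length xs < N → ∃ (_∉ xs)
missing-vertex {N} xs |xs|<N = Any.satisfied (All.¬All⇒Any¬ (_∈? xs) (allFin N) covers)
  where
  open DecMembership (_≟_ {N}) using (_∈?_)
  covers : ¬ All (_∈ xs) (allFin N)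
  covers all∈ = <⇒≱ |xs|<N
    (subst (_≤ length xs) (length-tabulate id) (unique-⊆⇒length-≤ (setoid (Fin N)) (allFin⁺ N) all∈))

complete-to-allFin : (xs : List (Fin (suc N))) → Unique xs → length xs ≡ N → ∃ λ u → u ∷ xs ↭ allFin (suc N)
complete-to-allFin xs u |xs|≡N with missing-vertex xs (s≤s (≤-reflexive |xs|≡N))
... | v , v∉xs = v , unique-length⇒↭-allFin (v∉ ∷ u) (cong suc |xs|≡N)
  where
  v∉ : All (v ≢_) xs
  v∉ = All.tabulate (λ x∈xs v≡x → v∉xs (subst (_∈ xs) (sym v≡x) x∈xs))

lookupTable : (xs : List (Fin K)) → List A → A → Fin K → A
lookupTable (x ∷ xs) (y ∷ ys) d i with x ≟ i
... | yes _ = y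
... | no  _ = lookupTable xs ys d i
lookupTable _ _ d _ = d

map-lookupTable : {xs : List (Fin K)} {ys : List A} (d : A) → Unique xs → length xs ≡ length ys →
  map (lookupTable xs ys d) xs ≡ ys
map-lookupTable {xs = []}     {[]}     d _          _ = refl
map-lookupTable {xs = x ∷ xs} {y ∷ ys} d (x∉xs ∷ u) e with x ≟ x
... | no  x≢x = ⊥-elim (x≢x refl)
... | yes _   = cong (y ∷_) (trans (map-cong-local (All.map skip x∉xs)) (map-lookupTable d u (suc-injective e)))
  where
  skip : {i : Fin _} → x ≢ i → lookupTable (x ∷ xs) (y ∷ ys) d i ≡ lookupTable xs ys d i
  skip {i} x≢i with x ≟ i
  ... | yes x≡i = ⊥-elim (x≢i x≡i)
  ... | no  _   = refl
map-lookupTable {xs = []}    {_ ∷ _} _ _ ()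
map-lookupTable {xs = _ ∷ _} {[]}    _ _ ()

length-flatten : (ps : List (A × A)) → length (flatten ps) ≡ 2 * length ps
length-flatten = length-concatMap-pairs (λ _ → refl)

pairUp : (n : ℕ) (xs : List A) → length xs ≡ 2 * n → Σ (Vec (A × A) n) λ ps → flatten (toList ps) ≡ xs
pairUp zero    []           _ = [] , refl
pairUp (suc n) (a ∷ b ∷ xs) e with pairUp n xs (suc-injective (suc-injective (trans e (*-suc 2 n))))
... | ps , flat≡xs = (a , b) ∷ ps , cong (λ ys → a ∷ b ∷ ys) flat≡xs
pairUp zero    (_ ∷ _)      ()
pairUp (suc n) []           ()
pairUp (suc n) (_ ∷ [])     e with trans e (*-suc 2 n)
... | ()

selected unselected : {n : ℕ} → Vec Bool n → Vec A n → List A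
selected []          []       = []
selected (true ∷ s)  (p ∷ ps) = p ∷ selected s ps
selected (false ∷ s) (p ∷ ps) = selected s ps
unselected []          []       = []
unselected (true ∷ s)  (p ∷ ps) = unselected s ps
unselected (false ∷ s) (p ∷ ps) = p ∷ unselected s ps

length-selected : {n : ℕ} (s : Vec Bool n) (ps : Vec A n) → length (selected s ps) ≡ trues s
length-selected []          []       = refl
length-selected (true ∷ s)  (p ∷ ps) = cong suc (length-selected s ps)
length-selected (false ∷ s) (p ∷ ps) = length-selected s ps

length-unselected : {n : ℕ} (s : Vec Bool n) (ps : Vec A n) → length (unselected s ps) ≡ falses s
length-unselected []          []       = refl
length-unselected (true ∷ s)  (p ∷ ps) = length-unselected s ps
length-unselected (false ∷ s) (p ∷ ps) = cong suc (length-unselected s ps)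

flatten-selected-↭ : {n : ℕ} (s : Vec Bool n) (ps : Vec (A × A) n) →
  flatten (selected s ps) ++ flatten (unselected s ps) ↭ flatten (toList ps)
flatten-selected-↭ []          []             = ↭.refl
flatten-selected-↭ (true ∷ s)  ((a , b) ∷ ps) = ↭.prep a (↭.prep b (flatten-selected-↭ s ps))
flatten-selected-↭ (false ∷ s) ((a , b) ∷ ps) =
  ↭.trans (↭.shifts (flatten (selected s ps)) (a ∷ b ∷ [])) (↭.prep a (↭.prep b (flatten-selected-↭ s ps)))

selection-differs : {n : ℕ} (s s′ : Vec Bool n) (ps : Vec A n) → s ≢ s′ →
  ∃ λ p → (p ∈ selected s ps × p ∈ unselected s′ ps) ⊎ (p ∈ unselected s ps × p ∈ selected s′ ps)
selection-differs []          []           []       s≢s′ = ⊥-elim (s≢s′ refl)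
selection-differs (true ∷ s)  (false ∷ s′) (p ∷ ps) _    = p , inj₁ (here refl , here refl)
selection-differs (false ∷ s) (true ∷ s′)  (p ∷ ps) _    = p , inj₂ (here refl , here refl)
selection-differs (true ∷ s)  (true ∷ s′)  (p ∷ ps) s≢s′
  with selection-differs s s′ ps (s≢s′ ∘ cong (true ∷_))
... | q , inj₁ (q∈ , q∈′) = q , inj₁ (there q∈ , q∈′)
... | q , inj₂ (q∈ , q∈′) = q , inj₂ (q∈ , there q∈′)
selection-differs (false ∷ s) (false ∷ s′) (p ∷ ps) s≢s′
  with selection-differs s s′ ps (s≢s′ ∘ cong (false ∷_))
... | q , inj₁ (q∈ , q∈′) = q , inj₁ (q∈ , there q∈′)
... | q , inj₂ (q∈ , q∈′) = q , inj₂ (there q∈ , q∈′)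

oneLadder : Fin N × Fin N → Ladder N
oneLadder p = ladder p []

module Extension {n : ℕ} (ps : Vec (Fin (suc (2 * n)) × Fin (suc (2 * n))) n)
  (split : zero ∷ flatten (toList ps) ↭ allFin (suc (2 * n))) (s : Vec Bool n)
  (F : List (Laddered (suc (2 * trues s)))) (F-maximal : MHMaximal (trues s) F) where

  F-compatible : CompatibleFamily F
  F-compatible = proj₁ F-maximal

  M : List (Fin (suc (2 * trues s)) × Fin (suc (2 * trues s)))
  M = proj₁ (proj₁ (proj₂ F-maximal))

  |M| : length M ≡ trues s
  |M| = proj₁ (proj₁ (proj₂ (proj₁ (proj₂ F-maximal))))

  M-unique : Unique (flatten M)
  M-unique = proj₂ (proj₁ (proj₂ (proj₁ (proj₂ F-maximal))))

  M-two : All (λ e → All (λ G → EdgeIn G (proj₁ e) (proj₂ e) two) F) M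
  M-two = proj₂ (proj₂ (proj₁ (proj₂ F-maximal)))

  F-yields : YieldsPaths F (trues s C ⌊ trues s /2⌋)
  F-yields = proj₂ (proj₂ F-maximal)

  extra : List (Ladder (suc (2 * n)))
  extra = map oneLadder (unselected s ps)

  |flatten-M| : length (flatten M) ≡ 2 * trues s
  |flatten-M| = trans (length-flatten M) (cong (2 *_) |M|)

  u₀ : Fin (suc (2 * trues s))
  u₀ = proj₁ (complete-to-allFin (flatten M) M-unique |flatten-M|)

  u₀M↭ : u₀ ∷ flatten M ↭ allFin (suc (2 * trues s))
  u₀M↭ = proj₂ (complete-to-allFin (flatten M) M-unique |flatten-M|)

  φ : Fin (suc (2 * trues s)) → Fin (suc (2 * n))
  φ = lookupTable (u₀ ∷ flatten M) (zero ∷ flatten (selected s ps)) zero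

  φ-table : map φ (u₀ ∷ flatten M) ≡ zero ∷ flatten (selected s ps)
  φ-table = map-lookupTable zero (unique-resp-↭ (↭-sym u₀M↭) (allFin⁺ _)) (cong suc (begin
    length (flatten M)              ≡⟨ |flatten-M| ⟩
    2 * trues s                     ≡⟨ cong (2 *_) (sym (length-selected s ps)) ⟩
    2 * length (selected s ps)      ≡⟨ sym (length-flatten (selected s ps)) ⟩
    length (flatten (selected s ps)) ∎))
    where open ≡-Reasoning

  cover : map φ (allFin (suc (2 * trues s))) ++ concatMap ladderVertices extra ↭ allFin (suc (2 * n))
  cover = begin
    map φ (allFin _) ++ concatMap ladderVertices extra
      ≡⟨ cong (map φ (allFin _) ++_) (concatMap-map ladderVertices oneLadder (unselected s ps)) ⟩
    map φ (allFin _) ++ flatten (unselected s ps)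
      ↭⟨ ↭.++⁺ʳ _ (↭.map⁺ φ (↭-sym u₀M↭)) ⟩
    map φ (u₀ ∷ flatten M) ++ flatten (unselected s ps)
      ≡⟨ cong (_++ flatten (unselected s ps)) φ-table ⟩
    zero ∷ flatten (selected s ps) ++ flatten (unselected s ps)
      ↭⟨ ↭.prep zero (flatten-selected-↭ s ps) ⟩
    zero ∷ flatten (toList ps)
      ↭⟨ split ⟩
    allFin _ ∎
    where open ↭.PermutationReasoning

  open Relabel φ
  open Extend extra cover

  extendedFamily : List (Laddered (suc (2 * n)))
  extendedFamily = map (λ G → extend G extra cover) F

  extendedFamily-compatible : CompatibleFamily extendedFamily
  extendedFamily-compatible = AllPairs.map⁺ (AllPairs.map (λ {G} {H} → compatible-extend {G} {H}) F-compatible)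

  M-selected : map φ² M ≡ selected s ps
  M-selected = flatten-injective _ _
    (trans (concatMap-map-natural {g = pairList} {pairList} {φ²} φ (λ _ → refl) M) (∷-injectiveʳ φ-table))

  selected-two : All (λ G → ∀ {p} → p ∈ selected s ps → EdgeIn G (proj₁ p) (proj₂ p) two) extendedFamily
  selected-two = All.map⁺ (All.tabulate two-in)
    where
    two-in : {G : Laddered _} → G ∈ F → {p : Fin _ × Fin _} → p ∈ selected s ps →
      EdgeIn (extend G extra cover) (proj₁ p) (proj₂ p) two
    two-in {G} G∈F p∈ with ∈-map⁻ φ² (subst (_ ∈_) (sym M-selected) p∈)
    ... | e , e∈M , refl = edgeIn-extend G (All.lookup (All.lookup M-two e∈M) G∈F)

  unselected-one : All (λ G → ∀ {p} → p ∈ unselected s ps → EdgeIn G (proj₁ p) (proj₂ p) one) extendedFamily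
  unselected-one = All.map⁺ (All.tabulate (λ {G} _ p∈ → edgeIn-extend-extra G (rung∈ p∈)))
    where
    rung∈ : {p : Fin _ × Fin _} {qs : List (Fin _ × Fin _)} → p ∈ qs →
      rungEdge p ∈ concatMap ladderEdges (map oneLadder qs)
    rung∈ (here refl) = here refl
    rung∈ (there p∈)  = there (rung∈ p∈)

  length-extendedFamily : length (zPathsFamily extendedFamily) ≡ 2 ^ falses s * (trues s C ⌊ trues s /2⌋)
  length-extendedFamily = begin
    length (zPathsFamily extendedFamily)
      ≡⟨ length-zPathsFamily-map (2 ^ length extra) length-zPaths-extend F ⟩
    2 ^ length extra * length (zPathsFamily F)
      ≡⟨ cong₂ (λ l c → 2 ^ l * c) (trans (length-map oneLadder (unselected s ps)) (length-unselected s ps))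
                                   (yieldsPaths⇒length F F-compatible F-yields) ⟩
    2 ^ falses s * (trues s C ⌊ trues s /2⌋) ∎
    where open ≡-Reasoning

trues-≤ : {n : ℕ} (s : Vec Bool n) → trues s ≤ n
trues-≤ s = subst (trues s ≤_) (falses+trues s) (m≤n+m (trues s) (falses s))

boolVecs-unique : (n : ℕ) → Unique (boolVecs n)
boolVecs-unique zero    = [] ∷ []
boolVecs-unique (suc n) = AllPairs.++⁺ (consed true) (consed false)
  (All.map⁺ (All.tabulate (λ _ → All.map⁺ (All.tabulate (λ _ ())))))
  where
  consed : (b : Bool) → Unique (map (b ∷_) (boolVecs n))
  consed b = AllPairs.map⁺ (AllPairs.map (λ s≢s′ → s≢s′ ∘ Vec.∷-injectiveʳ) (boolVecs-unique n))

singletonFamily : Σ (List (Laddered 1)) (MHMaximal 0)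
singletonFamily = point ∷ [] , ([] ∷ []) , ([] , (refl , []) , []) , yieldsPaths-length (point ∷ []) ([] ∷ [])
  where
  point : Laddered 1
  point = laddered zero empty [] ↭.refl

module HMaximalFamily (n : ℕ) (maximal : (k : ℕ) → k ≤ n → Σ (List (Laddered (suc (2 * k)))) (MHMaximal k)) where

  pairing : Σ (Vec (Fin (suc (2 * n)) × Fin (suc (2 * n))) n) λ ps → flatten (toList ps) ≡ tabulate suc
  pairing = pairUp n (tabulate suc) (length-tabulate suc)

  pairs : Vec (Fin (suc (2 * n)) × Fin (suc (2 * n))) n
  pairs = proj₁ pairing

  module E (s : Vec Bool n) = Extension pairs (↭.↭-reflexive (cong (zero ∷_) (proj₂ pairing))) s
    (proj₁ (maximal (trues s) (trues-≤ s))) (proj₂ (maximal (trues s) (trues-≤ s)))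

  family : List (Laddered (suc (2 * n)))
  family = concatMap E.extendedFamily (boolVecs n)

  compatible-across : {s s′ : Vec Bool n} →
    (∃ λ p → (p ∈ selected s pairs × p ∈ unselected s′ pairs)
           ⊎ (p ∈ unselected s pairs × p ∈ selected s′ pairs)) →
    All (λ G → All (Compatible G) (E.extendedFamily s′)) (E.extendedFamily s)
  compatible-across {s} {s′} (p , inj₁ (p∈ , p∈′)) = All.map (λ G-two → All.map (λ H-one →
    proj₁ p , proj₂ p , two , one , G-two p∈ , H-one p∈′ , λ ()) (E.unselected-one s′)) (E.selected-two s)
  compatible-across {s} {s′} (p , inj₂ (p∈ , p∈′)) = All.map (λ G-one → All.map (λ H-two →
    proj₁ p , proj₂ p , one , two , G-one p∈ , H-two p∈′ , λ ()) (E.selected-two s′)) (E.unselected-one s)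

  family-compatible : CompatibleFamily family
  family-compatible = allPairs-concatMap {f = E.extendedFamily} {S = Compatible} (boolVecs-unique n)
    (All.tabulate (λ {s} _ → E.extendedFamily-compatible s))
    (λ {s} {s′} s≢s′ → compatible-across {s} {s′} (selection-differs s s′ pairs s≢s′))

  length-family : length (zPathsFamily family) ≡ suc (2 * n) C n
  length-family = begin
    length (zPathsFamily family)
      ≡⟨ length-zPathsFamily-concatMap E.extendedFamily (boolVecs n) ⟩
    ∑ (boolVecs n) (λ s → length (zPathsFamily (E.extendedFamily s)))
      ≡⟨ ∑-cong (boolVecs n) E.length-extendedFamily ⟩
    ∑ (boolVecs n) (λ s → 2 ^ falses s * (trues s C ⌊ trues s /2⌋))
      ≡⟨ central-binomial-sum n ⟩
    suc (2 * n) C n ∎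
    where open ≡-Reasoning

lemma2p10 : (n : ℕ) → 1 ≤ n
    → ((k : ℕ) → 1 ≤ k → k ≤ n → Σ (List (Laddered (suc (2 * k)))) (MHMaximal k))
    → Σ (List (Laddered (suc (2 * n)))) (HMaximal n)
lemma2p10 n _ maximal =
  family , family-compatible , subst (YieldsPaths family) length-family (yieldsPaths-length family family-compatible)
  where
  maximal₀ : (k : ℕ) → k ≤ n → Σ (List (Laddered (suc (2 * k)))) (MHMaximal k)
  maximal₀ zero    _   = singletonFamily
  maximal₀ (suc k) k≤n = maximal (suc k) (s≤s z≤n) k≤n
  open HMaximalFamily n maximal₀
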